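{- Let $p$ be a prime and $a\in\{1,2,3\}$. Then for all integers $n$ with $2p/3\le n<p$, $$\sum_{k=0}^n(-1)^{ak}\binom{n}{k}^a\binom{4n-5k}{3n-2p}\equiv0\pmod p.$$
   Context: For integers $m\ge0$ and any number $x$, $\binom{x}{m}=\frac{x(x-1)\cdots(x-m+1)}{m!}$ (so the upper entry $4n-5k$ may be negative). -}

module Defs where

open import Data.Nat as ℕ using (ℕ; zero; suc)
open import Data.Nat.Combinatorics using (_C_)
open import Data.Nat.Base using (_!)
open import Data.Nat.Properties using (_!≢0)
open import Data.Integer as ℤ using (ℤ; +_; -_; _-_; _*_; _+_)
open import Data.Integer.DivMod using (_/ℕ_)

falling : ℤ → ℕ → ℤ
falling x zero    = + 1
falling x (suc m) = falling x m * (x - + m)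

-- generalized binomial coefficient (x choose m) = falling x m / m!  (exact division)
binomZ : ℤ → ℕ → ℤ
binomZ x m = (falling x m /ℕ (m !)) {{m !≢0}}

sgn : ℕ → ℤ
sgn zero    = + 1
sgn (suc e) = - sgn e

sumTo : ℕ → (ℕ → ℤ) → ℤ
sumTo zero    f = f 0
sumTo (suc n) f = sumTo n f + f (suc n)

-- Write p = n + r + 1 and m = 3n − 2p, so that p = m + 3r + 3. Modulo p,
-- r!·(−1)^k·C(n,k) ≡ (k+1)(k+2)⋯(k+r) for k ≤ n, since C(n,k+1)/C(n,k) = (n−k)/(k+1)
-- and n − k ≡ −(k+r+1). Hence (r!)^a·m! times the k-th summand is congruent to
--   g(k) = ((k+1)⋯(k+r))^a · (4n−5k)(4n−5k−1)⋯(4n−5k−m+1),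
-- a polynomial in k of degree ar + m ≤ p − 3. For n < k < p one of k+1, …, k+r equals p,
-- so the sum is congruent to Σ_{k<p} g(k). Expanding g in the basis C(k,j), j ≤ p − 3,
-- and using Σ_{k<p} C(k,j) = C(p,j+1) ≡ 0 shows that this vanishes mod p; finally p
-- divides neither r! nor m!.

{-# OPTIONS --safe #-}
module Submission where

open import Defs
open import Data.Nat as ℕ using (ℕ; zero; suc; _≤_; _<_; _∸_; _!; z≤n; s≤s)
open import Data.Nat.Primality using (Prime; euclidsLemma; prime⇒nonTrivial)
open import Data.Nat.Combinatorics using (_C_; nCk+nC[k+1]≡[n+1]C[k+1])
import Data.Nat.Divisibility as ℕ
import Data.Nat.Properties as ℕ
import Data.Nat.Tactic.RingSolver as ℕ-Solver
open import Data.Integer as ℤ using (ℤ; +_; -[1+_]; -_; _*_; _-_; _+_; _^_; 0ℤ; 1ℤ)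
open import Data.Integer.Divisibility using (_∣_)
open import Data.Integer.Divisibility.Signed as Signed using (divides; ∣ᵤ⇒∣; ∣⇒∣ᵤ)
  renaming (_∣_ to _∣ˢ_)
open import Data.Integer.DivMod using ([n/ℕd]*d≤n; n<s[n/ℕd]*d)
import Data.Integer.Properties as ℤ
open import Data.Integer.Tactic.RingSolver using (solve-∀)
open import Data.Vec using (Vec; []; _∷_)
open import Data.Product using (Σ-syntax; _,_)
open import Data.Sum using (_⊎_; inj₁; inj₂)
open import Relation.Nullary using (¬_; contradiction)
open import Relation.Binary.PropositionalEquality using (_≡_; refl; sym; trans; cong; cong₂; subst; module ≡-Reasoning)
open ≡-Reasoning

binom : ℕ → ℕ → ℕ
binom n       zero    = 1
binom zero    (suc k) = 0
binom (suc n) (suc k) = binom n k ℕ.+ binom n (suc k)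

C≡binom : ∀ n k → n C k ≡ binom n k
C≡binom n       zero    = refl
C≡binom zero    (suc k) = refl
C≡binom (suc n) (suc k) = begin
  suc n C suc k               ≡⟨ nCk+nC[k+1]≡[n+1]C[k+1] n k ⟨
  n C k ℕ.+ n C suc k         ≡⟨ cong₂ ℕ._+_ (C≡binom n k) (C≡binom n (suc k)) ⟩
  binom n k ℕ.+ binom n (suc k) ∎

binom-1 : ∀ n → binom n 1 ≡ n
binom-1 zero    = refl
binom-1 (suc n) = cong suc (binom-1 n)

binom-absorption : ∀ k j → suc j ℕ.* binom (suc k) (suc j) ≡ suc k ℕ.* binom k j
binom-absorption zero    zero    = refl
binom-absorption zero    (suc j) = ℕ.*-zeroʳ (suc (suc j))
binom-absorption (suc k) zero    = begin
  1 ℕ.* binom (suc (suc k)) 1 ≡⟨ ℕ.*-identityˡ _ ⟩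
  binom (suc (suc k)) 1       ≡⟨ binom-1 (suc (suc k)) ⟩
  suc (suc k)                 ≡⟨ ℕ.*-identityʳ _ ⟨
  suc (suc k) ℕ.* 1           ∎
binom-absorption (suc k) (suc j) = begin
  suc (suc j) ℕ.* (b₁ ℕ.+ b₂)                   ≡⟨ expand j b₁ b₂ ⟩
  suc j ℕ.* b₁ ℕ.+ b₁ ℕ.+ suc (suc j) ℕ.* b₂
    ≡⟨ cong₂ (λ u v → u ℕ.+ b₁ ℕ.+ v) (binom-absorption k j) (binom-absorption k (suc j)) ⟩
  suc k ℕ.* c₀ ℕ.+ (c₀ ℕ.+ c₁) ℕ.+ suc k ℕ.* c₁ ≡⟨ collect k c₀ c₁ ⟩
  suc (suc k) ℕ.* (c₀ ℕ.+ c₁)                   ∎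
  where
  c₀ = binom k j
  c₁ = binom k (suc j)
  b₁ = binom (suc k) (suc j)
  b₂ = binom (suc k) (suc (suc j))
  expand : ∀ j x y → suc (suc j) ℕ.* (x ℕ.+ y) ≡ suc j ℕ.* x ℕ.+ x ℕ.+ suc (suc j) ℕ.* y
  expand = ℕ-Solver.solve-∀
  collect : ∀ k x y → suc k ℕ.* x ℕ.+ (x ℕ.+ y) ℕ.+ suc k ℕ.* y ≡ suc (suc k) ℕ.* (x ℕ.+ y)
  collect = ℕ-Solver.solve-∀

*-binom-expansion : ∀ k j → k ℕ.* binom k j ≡ j ℕ.* binom k j ℕ.+ suc j ℕ.* binom k (suc j)
*-binom-expansion zero    zero    = refl
*-binom-expansion zero    (suc j) = sym (cong₂ ℕ._+_ (ℕ.*-zeroʳ (suc j)) (ℕ.*-zeroʳ (suc (suc j))))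
*-binom-expansion (suc k) zero    = begin
  suc k ℕ.* 1            ≡⟨ ℕ.*-identityʳ (suc k) ⟩
  suc k                  ≡⟨ binom-1 (suc k) ⟨
  binom (suc k) 1        ≡⟨ ℕ.+-identityʳ _ ⟨
  1 ℕ.* binom (suc k) 1  ∎
*-binom-expansion (suc k) (suc j) = begin
  suc k ℕ.* (binom k j ℕ.+ binom k (suc j))
    ≡⟨ ℕ.*-distribˡ-+ (suc k) (binom k j) (binom k (suc j)) ⟩
  suc k ℕ.* binom k j ℕ.+ suc k ℕ.* binom k (suc j)
    ≡⟨ cong₂ ℕ._+_ (binom-absorption k j) (binom-absorption k (suc j)) ⟨
  suc j ℕ.* binom (suc k) (suc j) ℕ.+ suc (suc j) ℕ.* binom (suc k) (suc (suc j)) ∎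

*-binom-expansionℤ : ∀ k j → + k * + binom k j ≡ + j * + binom k j + + suc j * + binom k (suc j)
*-binom-expansionℤ k j = begin
  + k * + binom k j                                      ≡⟨ ℤ.pos-* k (binom k j) ⟨
  + (k ℕ.* binom k j)                                    ≡⟨ cong +_ (*-binom-expansion k j) ⟩
  + (j ℕ.* binom k j ℕ.+ suc j ℕ.* binom k (suc j))      ≡⟨ ℤ.pos-+ (j ℕ.* binom k j) _ ⟩
  + (j ℕ.* binom k j) + + (suc j ℕ.* binom k (suc j))    ≡⟨ cong₂ _+_ (ℤ.pos-* j _) (ℤ.pos-* (suc j) _) ⟩
  + j * + binom k j + + suc j * + binom k (suc j)        ∎

prime∣binom : ∀ {p} j → Prime p → suc j < p → p ℕ.∣ binom p (suc j)
prime∣binom {suc q} j isPrime 1+j<p with euclidsLemma (suc j) (binom (suc q) (suc j)) isPrime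
  (subst (suc q ℕ.∣_) (sym (binom-absorption q j)) (ℕ.m∣m*n (binom q j)))
... | inj₁ p∣1+j = contradiction p∣1+j (ℕ.>⇒∤ 1+j<p)
... | inj₂ p∣binom = p∣binom

sumTo-cong : ∀ N {f g : ℕ → ℤ} → (∀ k → f k ≡ g k) → sumTo N f ≡ sumTo N g
sumTo-cong zero    f≡g = f≡g 0
sumTo-cong (suc N) f≡g = cong₂ _+_ (sumTo-cong N f≡g) (f≡g (suc N))

sumTo-+ : ∀ N (f g : ℕ → ℤ) → sumTo N (λ k → f k + g k) ≡ sumTo N f + sumTo N g
sumTo-+ zero    f g = refl
sumTo-+ (suc N) f g = begin
  sumTo N (λ k → f k + g k) + (f (suc N) + g (suc N)) ≡⟨ cong (_+ (f (suc N) + g (suc N))) (sumTo-+ N f g) ⟩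
  sumTo N f + sumTo N g + (f (suc N) + g (suc N))     ≡⟨ interchange (sumTo N f) (sumTo N g) (f (suc N)) (g (suc N)) ⟩
  sumTo N f + f (suc N) + (sumTo N g + g (suc N))     ∎
  where
  interchange : ∀ a b c d → a + b + (c + d) ≡ a + c + (b + d)
  interchange = solve-∀

sumTo-* : ∀ N c (f : ℕ → ℤ) → sumTo N (λ k → c * f k) ≡ c * sumTo N f
sumTo-* zero    c f = refl
sumTo-* (suc N) c f = begin
  sumTo N (λ k → c * f k) + c * f (suc N) ≡⟨ cong (_+ c * f (suc N)) (sumTo-* N c f) ⟩
  c * sumTo N f + c * f (suc N)           ≡⟨ ℤ.*-distribˡ-+ c (sumTo N f) (f (suc N)) ⟨
  c * (sumTo N f + f (suc N))             ∎

sumTo-0 : ∀ N → sumTo N (λ _ → 0ℤ) ≡ 0ℤ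
sumTo-0 zero    = refl
sumTo-0 (suc N) = trans (ℤ.+-identityʳ _) (sumTo-0 N)

sumTo-binom : ∀ q j → sumTo q (λ k → + binom k j) ≡ + binom (suc q) (suc j)
sumTo-binom zero    zero    = refl
sumTo-binom zero    (suc j) = refl
sumTo-binom (suc q) j = begin
  sumTo q (λ k → + binom k j) + + binom (suc q) j ≡⟨ cong (_+ + binom (suc q) j) (sumTo-binom q j) ⟩
  + (binom (suc q) (suc j) ℕ.+ binom (suc q) j)  ≡⟨ cong +_ (ℕ.+-comm (binom (suc q) (suc j)) (binom (suc q) j)) ⟩
  + binom (suc (suc q)) (suc j)                   ∎

∣-sumTo : ∀ {P} N {f : ℕ → ℤ} → (∀ k → k ≤ N → P ∣ˢ f k) → P ∣ˢ sumTo N f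
∣-sumTo zero    P∣f = P∣f 0 z≤n
∣-sumTo (suc N) P∣f =
  Signed.∣m∣n⇒∣m+n (∣-sumTo N (λ k k≤N → P∣f k (ℕ.m≤n⇒m≤1+n k≤N))) (P∣f (suc N) ℕ.≤-refl)

∣-sumTo-congruent : ∀ {P} N (f g : ℕ → ℤ) →
  (∀ k → k ≤ N → P ∣ˢ f k - g k) → P ∣ˢ sumTo N g → P ∣ˢ sumTo N f
∣-sumTo-congruent {P} N f g P∣f-g P∣Σg =
  subst (P ∣ˢ_) Σ[f-g]+Σg≡Σf (Signed.∣m∣n⇒∣m+n (∣-sumTo N P∣f-g) P∣Σg)
  where
  sub-add : ∀ x y → x - y + y ≡ x
  sub-add = solve-∀
  Σ[f-g]+Σg≡Σf : sumTo N (λ k → f k - g k) + sumTo N g ≡ sumTo N f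
  Σ[f-g]+Σg≡Σf = begin
    sumTo N (λ k → f k - g k) + sumTo N g ≡⟨ sumTo-+ N (λ k → f k - g k) g ⟨
    sumTo N (λ k → f k - g k + g k)       ≡⟨ sumTo-cong N (λ k → sub-add (f k) (g k)) ⟩
    sumTo N f                             ∎

∣-sumTo-drop : ∀ {P} (f : ℕ → ℤ) n t →
  (∀ j → j < t → P ∣ˢ f (suc (j ℕ.+ n))) → P ∣ˢ sumTo (t ℕ.+ n) f → P ∣ˢ sumTo n f
∣-sumTo-drop f n zero    P∣tail P∣Σ = P∣Σ
∣-sumTo-drop f n (suc t) P∣tail P∣Σ = ∣-sumTo-drop f n t (λ j j<t → P∣tail j (ℕ.m≤n⇒m≤1+n j<t))
  (Signed.∣m+n∣n⇒∣m P∣Σ (P∣tail t ℕ.≤-refl))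

prime>1 : ∀ {p} → Prime p → 1 < p
prime>1 {p} isPrime = ℕ.nonTrivial⇒n>1 p {{prime⇒nonTrivial isPrime}}

prime∤! : ∀ {p} → Prime p → ∀ {m} → m < p → ¬ p ℕ.∣ m !
prime∤! isPrime {zero}  m<p p∣1 = ℕ.>⇒∤ (prime>1 isPrime) p∣1
prime∤! isPrime {suc m} m<p p∣m! with euclidsLemma (suc m) (m !) isPrime p∣m!
... | inj₁ p∣1+m = ℕ.>⇒∤ m<p p∣1+m
... | inj₂ p∣m!  = prime∤! isPrime (ℕ.<-trans (ℕ.n<1+n m) m<p) p∣m!

prime∣*⇒∣⊎∣ : ∀ {p} → Prime p → ∀ x y → + p ∣ˢ x * y → + p ∣ˢ x ⊎ + p ∣ˢ y
prime∣*⇒∣⊎∣ {p} isPrime x y p∣xy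
  with euclidsLemma ℤ.∣ x ∣ ℤ.∣ y ∣ isPrime (subst (p ℕ.∣_) (ℤ.abs-* x y) (∣⇒∣ᵤ p∣xy))
... | inj₁ p∣x = inj₁ (∣ᵤ⇒∣ p∣x)
... | inj₂ p∣y = inj₂ (∣ᵤ⇒∣ p∣y)

prime∣*-cancelˡ : ∀ {p x y} → Prime p → ¬ + p ∣ˢ x → + p ∣ˢ x * y → + p ∣ˢ y
prime∣*-cancelˡ {x = x} {y} isPrime p∤x p∣xy with prime∣*⇒∣⊎∣ isPrime x y p∣xy
... | inj₁ p∣x = contradiction p∣x p∤x
... | inj₂ p∣y = p∣y

prime∤^ : ∀ {p x} → Prime p → ¬ + p ∣ˢ x → ∀ a → ¬ + p ∣ˢ x ^ a
prime∤^ isPrime p∤x zero    p∣1   = ℕ.>⇒∤ (prime>1 isPrime) (∣⇒∣ᵤ p∣1)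
prime∤^ {x = x} isPrime p∤x (suc a) p∣xxᵃ with prime∣*⇒∣⊎∣ isPrime x (x ^ a) p∣xxᵃ
... | inj₁ p∣x  = p∤x p∣x
... | inj₂ p∣xᵃ = prime∤^ isPrime p∤x a p∣xᵃ

^-distribʳ-* : ∀ x y a → (x * y) ^ a ≡ x ^ a * y ^ a
^-distribʳ-* x y zero    = refl
^-distribʳ-* x y (suc a) = begin
  x * y * (x * y) ^ a     ≡⟨ cong (x * y *_) (^-distribʳ-* x y a) ⟩
  x * y * (x ^ a * y ^ a) ≡⟨ interchange x y (x ^ a) (y ^ a) ⟩
  x * x ^ a * (y * y ^ a) ∎
  where
  interchange : ∀ a b c d → a * b * (c * d) ≡ a * c * (b * d)
  interchange = solve-∀

∣-^-sub : ∀ {P} x y a → P ∣ˢ x - y → P ∣ˢ x ^ a - y ^ a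
∣-^-sub {P} x y zero    _     = divides 0ℤ (sym (ℤ.*-zeroˡ P))
∣-^-sub {P} x y (suc a) P∣x-y = subst (P ∣ˢ_) (telescope x y (x ^ a) (y ^ a))
  (Signed.∣m∣n⇒∣m+n (Signed.∣n⇒∣m*n x (∣-^-sub x y a P∣x-y)) (Signed.∣n⇒∣m*n (y ^ a) P∣x-y))
  where
  telescope : ∀ x y u v → x * (u - v) + v * (x - y) ≡ x * u - y * v
  telescope = solve-∀

sgn-+ : ∀ m n → sgn (m ℕ.+ n) ≡ sgn m * sgn n
sgn-+ zero    n = sym (ℤ.*-identityˡ (sgn n))
sgn-+ (suc m) n = trans (cong -_ (sgn-+ m n)) (ℤ.neg-distribˡ-* (sgn m) (sgn n))

sgn-* : ∀ a k → sgn (a ℕ.* k) ≡ sgn k ^ a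
sgn-* zero    k = refl
sgn-* (suc a) k = trans (sgn-+ k (a ℕ.* k)) (cong (sgn k *_) (sgn-* a k))

falling-shift : ∀ x m → falling x (suc m) ≡ x * falling (x - 1ℤ) m
falling-shift x zero    = unit x
  where
  unit : ∀ x → 1ℤ * (x - 0ℤ) ≡ x * 1ℤ
  unit = solve-∀
falling-shift x (suc m) = begin
  falling x (suc m) * (x - + suc m)        ≡⟨ cong (_* (x - + suc m)) (falling-shift x m) ⟩
  x * falling (x - 1ℤ) m * (x - + suc m)   ≡⟨ reassociate x (falling (x - 1ℤ) m) (+ m) ⟩
  x * (falling (x - 1ℤ) m * (x - 1ℤ - + m)) ∎
  where
  reassociate : ∀ x F m → x * F * (x - (1ℤ + m)) ≡ x * (F * (x - 1ℤ - m))
  reassociate = solve-∀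

falling-pos : ∀ t m → falling (+ t) m ≡ + (binom t m ℕ.* m !)
falling-pos t       zero    = refl
falling-pos zero    (suc m) = trans (falling-shift 0ℤ m) (ℤ.*-zeroˡ (falling (0ℤ - 1ℤ) m))
falling-pos (suc t) (suc m) = begin
  falling (+ suc t) (suc m)         ≡⟨ falling-shift (+ suc t) m ⟩
  + suc t * falling (+ t) m         ≡⟨ cong (+ suc t *_) (falling-pos t m) ⟩
  + suc t * + (binom t m ℕ.* m !)   ≡⟨ ℤ.pos-* (suc t) _ ⟨
  + (suc t ℕ.* (binom t m ℕ.* m !)) ≡⟨ cong +_ (ℕ.*-assoc (suc t) (binom t m) (m !)) ⟨
  + (suc t ℕ.* binom t m ℕ.* m !)   ≡⟨ cong (λ z → + (z ℕ.* m !)) (binom-absorption t m) ⟨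
  + (suc m ℕ.* binom (suc t) (suc m) ℕ.* m !) ≡⟨ cong +_ (swap (suc m) (binom (suc t) (suc m)) (m !)) ⟩
  + (binom (suc t) (suc m) ℕ.* (suc m ℕ.* m !)) ∎
  where
  swap : ∀ a b c → a ℕ.* b ℕ.* c ≡ b ℕ.* (a ℕ.* c)
  swap = ℕ-Solver.solve-∀

falling-neg : ∀ y m → falling (- y) m ≡ sgn m * falling (y + + m - 1ℤ) m
falling-neg y zero    = refl
falling-neg y (suc m) = begin
  falling (- y) m * (- y - + m)                   ≡⟨ cong (_* (- y - + m)) (falling-neg y m) ⟩
  sgn m * F * (- y - + m)                         ≡⟨ rearrange (sgn m) F y (+ m) ⟩
  - sgn m * ((y + + suc m - 1ℤ) * F)
    ≡⟨ cong (λ z → - sgn m * ((y + + suc m - 1ℤ) * falling z m)) (shift y (+ m)) ⟨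
  - sgn m * ((y + + suc m - 1ℤ) * falling (y + + suc m - 1ℤ - 1ℤ) m)
    ≡⟨ cong (- sgn m *_) (falling-shift (y + + suc m - 1ℤ) m) ⟨
  - sgn m * falling (y + + suc m - 1ℤ) (suc m)    ∎
  where
  F = falling (y + + m - 1ℤ) m
  rearrange : ∀ s F y m → s * F * (- y - m) ≡ - s * ((y + (1ℤ + m) - 1ℤ) * F)
  rearrange = solve-∀
  shift : ∀ y m → y + (1ℤ + m) - 1ℤ - 1ℤ ≡ y + m - 1ℤ
  shift = solve-∀

!∣falling : ∀ m x → + (m !) ∣ˢ falling x m
!∣falling m (+ t)    = divides (+ binom t m) (trans (falling-pos t m) (ℤ.pos-* (binom t m) (m !)))
!∣falling m -[1+ t ] = subst (+ (m !) ∣ˢ_) (sym (falling-neg (+ suc t) m))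
  (Signed.∣n⇒∣m*n (sgn m) (!∣falling m (+ (t ℕ.+ m))))

∣-falling : ∀ x {i} m → i < m → x - + i ∣ˢ falling x m
∣-falling x (suc m) i<1+m with ℕ.m≤n⇒m<n∨m≡n (ℕ.s≤s⁻¹ i<1+m)
... | inj₁ i<m  = Signed.∣m⇒∣m*n (x - + m) (∣-falling x m i<m)
... | inj₂ refl = Signed.∣n⇒∣m*n (falling x m) Signed.∣-refl

/ℕ-exact : ∀ t d .{{_ : ℕ.NonZero d}} → (t * + d) ℤ./ℕ d ≡ t
/ℕ-exact t d@(suc _) = ℤ.≤-antisym q≤t t≤q
  where
  q = (t * + d) ℤ./ℕ d
  q≤t : q ℤ.≤ t
  q≤t = ℤ.*-cancelʳ-≤-pos q t (+ d) ([n/ℕd]*d≤n (t * + d) d)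
  t≤q : t ℤ.≤ q
  t≤q = subst (t ℤ.≤_) (ℤ.pred-suc q)
    (ℤ.i<j⇒i≤pred[j] (ℤ.*-cancelʳ-<-nonNeg {t} {ℤ.suc q} (+ d) (n<s[n/ℕd]*d (t * + d) d)))

!*binomZ : ∀ x m → + (m !) * binomZ x m ≡ falling x m
!*binomZ x m with !∣falling m x
... | divides t eq = begin
  + (m !) * binomZ x m                             ≡⟨ cong (λ z → + (m !) * (z ℤ./ℕ m !) {{m ℕ.!≢0}}) eq ⟩
  + (m !) * ((t * + (m !)) ℤ./ℕ m !) {{m ℕ.!≢0}} ≡⟨ cong (+ (m !) *_) (/ℕ-exact t (m !) {{m ℕ.!≢0}}) ⟩
  + (m !) * t                                      ≡⟨ ℤ.*-comm (+ (m !)) t ⟩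
  t * + (m !)                                      ≡⟨ eq ⟨
  falling x m                                      ∎

-- evalFrom j cs k = Σᵢ csᵢ·C(k, j+i), so Polynomial d f says that f is an integer
-- combination of C(k,0), …, C(k,d), i.e. an integer-valued polynomial of degree ≤ d.
evalFrom : ∀ {n} → ℕ → Vec ℤ n → ℕ → ℤ
evalFrom j []       k = 0ℤ
evalFrom j (c ∷ cs) k = c * + binom k j + evalFrom (suc j) cs k

Polynomial : ℕ → (ℕ → ℤ) → Set
Polynomial d f = Σ[ cs ∈ Vec ℤ (suc d) ] (∀ k → f k ≡ evalFrom 0 cs k)

-- Multiplication by u·k + c in the basis C(k, j+i), using k·C(k,J) = J·C(k,J) + (J+1)·C(k,J+1):
-- the second term moves each coefficient up one index, where it arrives as the carry.
mulLinear : ∀ {n} → ℤ → ℤ → ℕ → ℤ → Vec ℤ n → Vec ℤ (suc n)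
mulLinear u c j carry []       = u * + j * carry ∷ []
mulLinear u c j carry (a ∷ as) = (u * + j + c) * a + u * + j * carry ∷ mulLinear u c (suc j) a as

evalFrom-mulLinear : ∀ {n} u c j carry (cs : Vec ℤ n) k →
  evalFrom j (mulLinear u c j carry cs) k ≡ (u * + k + c) * evalFrom j cs k + u * + j * carry * + binom k j
evalFrom-mulLinear u c j carry []       k = swap (u * + j * carry * + binom k j) (u * + k + c)
  where
  swap : ∀ x y → x + 0ℤ ≡ y * 0ℤ + x
  swap = solve-∀
evalFrom-mulLinear u c j carry (a ∷ as) k = begin
  ((u * J + c) * a + u * J * carry) * B₀ + evalFrom (suc j) (mulLinear u c (suc j) a as) k
    ≡⟨ cong (_+_ (((u * J + c) * a + u * J * carry) * B₀)) (evalFrom-mulLinear u c (suc j) a as k) ⟩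
  ((u * J + c) * a + u * J * carry) * B₀ + ((u * K + c) * E + u * J₁ * a * B₁)
    ≡⟨ regroup u c a carry K J J₁ B₀ B₁ E ⟩
  (u * K + c) * E + u * J * carry * B₀ + c * a * B₀ + u * a * (J * B₀ + J₁ * B₁)
    ≡⟨ cong (λ z → (u * K + c) * E + u * J * carry * B₀ + c * a * B₀ + u * a * z) (*-binom-expansionℤ k j) ⟨
  (u * K + c) * E + u * J * carry * B₀ + c * a * B₀ + u * a * (K * B₀)
    ≡⟨ collect u c a carry K J B₀ E ⟩
  (u * K + c) * (a * B₀ + E) + u * J * carry * B₀ ∎
  where
  K = + k
  J = + j
  J₁ = + suc j
  B₀ = + binom k j
  B₁ = + binom k (suc j)
  E = evalFrom (suc j) as k
  regroup : ∀ u c a carry K J J₁ B₀ B₁ E →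
    ((u * J + c) * a + u * J * carry) * B₀ + ((u * K + c) * E + u * J₁ * a * B₁)
      ≡ (u * K + c) * E + u * J * carry * B₀ + c * a * B₀ + u * a * (J * B₀ + J₁ * B₁)
  regroup = solve-∀
  collect : ∀ u c a carry K J B₀ E →
    (u * K + c) * E + u * J * carry * B₀ + c * a * B₀ + u * a * (K * B₀)
      ≡ (u * K + c) * (a * B₀ + E) + u * J * carry * B₀
  collect = solve-∀

polynomial-ext : ∀ {d f g} → (∀ k → f k ≡ g k) → Polynomial d f → Polynomial d g
polynomial-ext f≡g (cs , f≡cs) = cs , λ k → trans (sym (f≡g k)) (f≡cs k)

polynomial-const : ∀ c → Polynomial 0 (λ _ → c)
polynomial-const c = c ∷ [] , λ k → sym (trans (ℤ.+-identityʳ (c * 1ℤ)) (ℤ.*-identityʳ c))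

polynomial-*-linear : ∀ {d f} u c → Polynomial d f → Polynomial (suc d) (λ k → (u * + k + c) * f k)
polynomial-*-linear {f = f} u c (cs , f≡cs) = mulLinear u c 0 0ℤ cs , λ k → begin
  (u * + k + c) * f k                                       ≡⟨ cong ((u * + k + c) *_) (f≡cs k) ⟩
  (u * + k + c) * evalFrom 0 cs k                           ≡⟨ no-carry ((u * + k + c) * evalFrom 0 cs k) u ⟨
  (u * + k + c) * evalFrom 0 cs k + u * + 0 * 0ℤ * + 1      ≡⟨ evalFrom-mulLinear u c 0 0ℤ cs k ⟨
  evalFrom 0 (mulLinear u c 0 0ℤ cs) k                      ∎
  where
  no-carry : ∀ x u → x + u * 0ℤ * 0ℤ * 1ℤ ≡ x
  no-carry = solve-∀

polynomial-*-falling : ∀ {d f} u c m → Polynomial d f → Polynomial (m ℕ.+ d) (λ k → falling (u * + k + c) m * f k)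
polynomial-*-falling {f = f} u c zero    poly = polynomial-ext (λ k → sym (ℤ.*-identityˡ (f k))) poly
polynomial-*-falling {f = f} u c (suc m) poly =
  polynomial-ext next-factor (polynomial-*-linear u (c - + m) (polynomial-*-falling u c m poly))
  where
  reorder : ∀ u K c M F G → (u * K + (c - M)) * (F * G) ≡ F * (u * K + c - M) * G
  reorder = solve-∀
  next-factor : ∀ k → (u * + k + (c - + m)) * (falling (u * + k + c) m * f k) ≡ falling (u * + k + c) (suc m) * f k
  next-factor k = reorder u (+ k) c (+ m) (falling (u * + k + c) m) (f k)

polynomial-*-falling^ : ∀ {d f} u c m b → Polynomial d f →
  Polynomial (b ℕ.* m ℕ.+ d) (λ k → falling (u * + k + c) m ^ b * f k)
polynomial-*-falling^ {f = f} u c m zero    poly = polynomial-ext (λ k → sym (ℤ.*-identityˡ (f k))) poly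
polynomial-*-falling^ {d} {f} u c m (suc b) poly =
  subst (λ e → Polynomial e (λ k → F k ^ suc b * f k)) (sym (ℕ.+-assoc m (b ℕ.* m) d))
    (polynomial-ext (λ k → sym (ℤ.*-assoc (F k) (F k ^ b) (f k)))
      (polynomial-*-falling u c m (polynomial-*-falling^ u c m b poly)))
  where
  F : ℕ → ℤ
  F k = falling (u * + k + c) m

polynomial-falling : ∀ u c m → Polynomial m (λ k → falling (u * + k + c) m)
polynomial-falling u c m = subst (λ e → Polynomial e (λ k → falling (u * + k + c) m)) (ℕ.+-identityʳ m)
  (polynomial-ext (λ k → ℤ.*-identityʳ (falling (u * + k + c) m)) (polynomial-*-falling u c m (polynomial-const 1ℤ)))

sumTo-evalFrom : ∀ {n} q j (cs : Vec ℤ n) → sumTo q (evalFrom j cs) ≡ evalFrom (suc j) cs (suc q)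
sumTo-evalFrom q j []       = sumTo-0 q
sumTo-evalFrom q j (c ∷ cs) = begin
  sumTo q (λ k → c * + binom k j + evalFrom (suc j) cs k)
    ≡⟨ sumTo-+ q (λ k → c * + binom k j) (evalFrom (suc j) cs) ⟩
  sumTo q (λ k → c * + binom k j) + sumTo q (evalFrom (suc j) cs)
    ≡⟨ cong₂ _+_ (sumTo-* q c (λ k → + binom k j)) (sumTo-evalFrom q (suc j) cs) ⟩
  c * sumTo q (λ k → + binom k j) + evalFrom (suc (suc j)) cs (suc q)
    ≡⟨ cong (λ z → c * z + evalFrom (suc (suc j)) cs (suc q)) (sumTo-binom q j) ⟩
  c * + binom (suc q) (suc j) + evalFrom (suc (suc j)) cs (suc q) ∎

prime∣evalFrom : ∀ {p n} → Prime p → ∀ j (cs : Vec ℤ n) → j ℕ.+ n < p → + p ∣ˢ evalFrom (suc j) cs p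
prime∣evalFrom isPrime j []       _ = divides 0ℤ refl
prime∣evalFrom {p} {suc n} isPrime j (c ∷ cs) j+1+n<p = Signed.∣m∣n⇒∣m+n
  (Signed.∣n⇒∣m*n c (∣ᵤ⇒∣ (prime∣binom j isPrime (ℕ.≤-<-trans (ℕ.m≤m+n (suc j) n) 1+j+n<p))))
  (prime∣evalFrom isPrime (suc j) cs 1+j+n<p)
  where
  1+j+n<p : suc j ℕ.+ n < p
  1+j+n<p = subst (_< p) (ℕ.+-suc j n) j+1+n<p

prime∣sumTo-polynomial : ∀ {q d f} → Prime (suc q) → Polynomial d f → d < q → + suc q ∣ˢ sumTo q f
prime∣sumTo-polynomial {q} isPrime (cs , f≡cs) d<q =
  subst (+ suc q ∣ˢ_) (sym (trans (sumTo-cong q f≡cs) (sumTo-evalFrom q 0 cs))) (prime∣evalFrom isPrime 0 cs (s≤s d<q))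

falling-diag : ∀ r → falling (+ r) r ≡ + (r !)
falling-diag zero    = refl
falling-diag (suc r) = begin
  falling (+ suc r) (suc r) ≡⟨ falling-shift (+ suc r) r ⟩
  + suc r * falling (+ r) r ≡⟨ cong (+ suc r *_) (falling-diag r) ⟩
  + suc r * + (r !)         ≡⟨ ℤ.pos-* (suc r) (r !) ⟨
  + (suc r !)               ∎

falling-rising-step : ∀ k r → falling (+ (suc k ℕ.+ r)) r * + suc k ≡ + (suc k ℕ.+ r) * falling (+ (k ℕ.+ r)) r
falling-rising-step k r = begin
  falling x r * + suc k      ≡⟨ cong (falling x r *_) x-r≡1+k ⟨
  falling x r * (x - + r)    ≡⟨ falling-shift x r ⟩
  x * falling (x - 1ℤ) r     ∎
  where
  x = + (suc k ℕ.+ r)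
  cancel : ∀ a b → a + b - b ≡ a
  cancel = solve-∀
  x-r≡1+k : x - + r ≡ + suc k
  x-r≡1+k = trans (cong (_- + r) (ℤ.pos-+ (suc k) r)) (cancel (+ suc k) (+ r))

signed-binom-congruence : ∀ {n r} → Prime (suc (n ℕ.+ r)) → ∀ k → k ≤ n →
  + suc (n ℕ.+ r) ∣ˢ + (r !) * sgn k * + binom n k - falling (+ (k ℕ.+ r)) r
signed-binom-congruence {n} {r} _ zero _ = divides 0ℤ (begin
  + (r !) * 1ℤ * 1ℤ - falling (+ r) r ≡⟨ cong (_-_ (+ (r !) * 1ℤ * 1ℤ)) (falling-diag r) ⟩
  + (r !) * 1ℤ * 1ℤ - + (r !)         ≡⟨ vanish (+ (r !)) (+ suc (n ℕ.+ r)) ⟩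
  0ℤ * + suc (n ℕ.+ r)                ∎)
  where
  vanish : ∀ x P → x * 1ℤ * 1ℤ - x ≡ 0ℤ * P
  vanish = solve-∀
signed-binom-congruence {n} {r} isPrime (suc k) 1+k≤n =
  prime∣*-cancelˡ isPrime p∤1+k (subst (P ∣ˢ_) (sym step) P∣rhs)
  where
  P = + suc (n ℕ.+ r)
  X₀ = + (r !) * sgn k * + binom n k
  F₀ = falling (+ (k ℕ.+ r)) r
  F₁ = falling (+ (suc k ℕ.+ r)) r
  p∤1+k : ¬ P ∣ˢ + suc k
  p∤1+k P∣1+k = ℕ.>⇒∤ (s≤s (ℕ.≤-trans 1+k≤n (ℕ.m≤m+n n r))) (∣⇒∣ᵤ P∣1+k)
  P∣rhs : P ∣ˢ - (+ n - + k) * (X₀ - F₀) - P * F₀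
  P∣rhs = Signed.∣m∣n⇒∣m-n (Signed.∣n⇒∣m*n (- (+ n - + k)) (signed-binom-congruence isPrime k (ℕ.<⇒≤ 1+k≤n)))
    (Signed.∣m⇒∣m*n F₀ Signed.∣-refl)
  distribute : ∀ K R s b₀ b₁ F₁ →
    (1ℤ + K) * (R * - s * b₁ - F₁) ≡ R * s * (K * b₀) - R * s * (K * b₀ + (1ℤ + K) * b₁) - F₁ * (1ℤ + K)
  distribute = solve-∀
  collect : ∀ N K ρ R s b₀ F₀ →
    R * s * (K * b₀) - R * s * (N * b₀) - (1ℤ + K + ρ) * F₀ ≡ - (N - K) * (R * s * b₀ - F₀) - (1ℤ + N + ρ) * F₀
  collect = solve-∀
  identity : ∀ N K ρ R s b₀ b₁ F₀ F₁ →
    N * b₀ ≡ K * b₀ + (1ℤ + K) * b₁ → F₁ * (1ℤ + K) ≡ (1ℤ + K + ρ) * F₀ →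
    (1ℤ + K) * (R * - s * b₁ - F₁) ≡ - (N - K) * (R * s * b₀ - F₀) - (1ℤ + N + ρ) * F₀
  identity N K ρ R s b₀ b₁ F₀ F₁ expand shift = begin
    (1ℤ + K) * (R * - s * b₁ - F₁)
      ≡⟨ distribute K R s b₀ b₁ F₁ ⟩
    R * s * (K * b₀) - R * s * (K * b₀ + (1ℤ + K) * b₁) - F₁ * (1ℤ + K)
      ≡⟨ cong₂ (λ u v → R * s * (K * b₀) - R * s * u - v) (sym expand) shift ⟩
    R * s * (K * b₀) - R * s * (N * b₀) - (1ℤ + K + ρ) * F₀
      ≡⟨ collect N K ρ R s b₀ F₀ ⟩
    - (N - K) * (R * s * b₀ - F₀) - (1ℤ + N + ρ) * F₀ ∎
  step : + suc k * (+ (r !) * sgn (suc k) * + binom n (suc k) - F₁) ≡ - (+ n - + k) * (X₀ - F₀) - P * F₀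
  step = identity (+ n) (+ k) (+ r) (+ (r !)) (sgn k) (+ binom n k) (+ binom n (suc k)) F₀ F₁
    (*-binom-expansionℤ n k) (falling-rising-step k r)

prime∣signed-binom-power-sum : ∀ {n r d f} a → Prime (suc (n ℕ.+ r)) → 1 ≤ a →
  Polynomial d f → a ℕ.* r ℕ.+ d < n ℕ.+ r →
  + suc (n ℕ.+ r) ∣ˢ sumTo n (λ k → sgn (a ℕ.* k) * (+ (n C k)) ^ a * f k)
prime∣signed-binom-power-sum {n} {r} {d} {f} a@(suc a′) isPrime _ poly deg<q =
  prime∣*-cancelˡ isPrime (prime∤^ isPrime p∤r! a)
    (subst (P ∣ˢ_) (sumTo-* n ((+ (r !)) ^ a) term)
      (∣-sumTo-congruent n (λ k → (+ (r !)) ^ a * term k) g scaled≡g P∣Σg))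
  where
  P = + suc (n ℕ.+ r)
  term : ℕ → ℤ
  term k = sgn (a ℕ.* k) * (+ (n C k)) ^ a * f k
  F : ℕ → ℤ
  F k = falling (+ (k ℕ.+ r)) r
  g : ℕ → ℤ
  g k = F k ^ a * f k

  p∤r! : ¬ P ∣ˢ + (r !)
  p∤r! P∣r! = prime∤! isPrime (s≤s (ℕ.m≤n+m r n)) (∣⇒∣ᵤ P∣r!)

  g-polynomial : Polynomial (a ℕ.* r ℕ.+ d) g
  g-polynomial = polynomial-ext (λ k → cong (λ x → falling (x + + r) r ^ a * f k) (ℤ.*-identityˡ (+ k)))
    (polynomial-*-falling^ 1ℤ (+ r) r a poly)

  P∣tail : ∀ j → j < r → P ∣ˢ g (suc (j ℕ.+ n))
  P∣tail j j<r = Signed.∣m⇒∣m*n (f k)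
    (Signed.∣m⇒∣m*n (F k ^ a′) (subst (_∣ˢ F k) k+r-j≡P (∣-falling (+ (k ℕ.+ r)) r j<r)))
    where
    k = suc (j ℕ.+ n)
    cancel : ∀ a b → a + b - a ≡ b
    cancel = solve-∀
    k+r-j≡P : + (k ℕ.+ r) - + j ≡ P
    k+r-j≡P = begin
      + (k ℕ.+ r) - + j           ≡⟨ cong (λ z → + z - + j) (ℕ.+-suc (j ℕ.+ n) r) ⟨
      + (j ℕ.+ n ℕ.+ suc r) - + j  ≡⟨ cong (λ z → + z - + j) (ℕ.+-assoc j n (suc r)) ⟩
      + (j ℕ.+ (n ℕ.+ suc r)) - + j ≡⟨ cong (_- + j) (ℤ.pos-+ j (n ℕ.+ suc r)) ⟩
      + j + + (n ℕ.+ suc r) - + j  ≡⟨ cancel (+ j) (+ (n ℕ.+ suc r)) ⟩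
      + (n ℕ.+ suc r)             ≡⟨ cong +_ (ℕ.+-suc n r) ⟩
      P                           ∎

  P∣Σg : P ∣ˢ sumTo n g
  P∣Σg = ∣-sumTo-drop g n r P∣tail
    (subst (λ N → P ∣ˢ sumTo N g) (ℕ.+-comm n r) (prime∣sumTo-polynomial isPrime g-polynomial deg<q))

  scaled≡g : ∀ k → k ≤ n → P ∣ˢ (+ (r !)) ^ a * term k - g k
  scaled≡g k k≤n = subst (P ∣ˢ_) difference
    (Signed.∣m⇒∣m*n (f k) (∣-^-sub X (F k) a (signed-binom-congruence isPrime k k≤n)))
    where
    X = + (r !) * sgn k * + binom n k
    reorder : ∀ R s b t → R * (s * b * t) ≡ R * s * b * t
    reorder = solve-∀
    distrib : ∀ x y z → (x - y) * z ≡ x * z - y * z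
    distrib = solve-∀
    scaled-term : (+ (r !)) ^ a * term k ≡ X ^ a * f k
    scaled-term = begin
      (+ (r !)) ^ a * (sgn (a ℕ.* k) * (+ (n C k)) ^ a * f k)
        ≡⟨ cong₂ (λ s b → (+ (r !)) ^ a * (s * (+ b) ^ a * f k)) (sgn-* a k) (C≡binom n k) ⟩
      (+ (r !)) ^ a * (sgn k ^ a * (+ binom n k) ^ a * f k)
        ≡⟨ reorder ((+ (r !)) ^ a) (sgn k ^ a) ((+ binom n k) ^ a) (f k) ⟩
      (+ (r !)) ^ a * sgn k ^ a * (+ binom n k) ^ a * f k
        ≡⟨ cong (λ z → z * (+ binom n k) ^ a * f k) (^-distribʳ-* (+ (r !)) (sgn k) a) ⟨
      (+ (r !) * sgn k) ^ a * (+ binom n k) ^ a * f k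
        ≡⟨ cong (_* f k) (^-distribʳ-* (+ (r !) * sgn k) (+ binom n k) a) ⟨
      X ^ a * f k ∎
    difference : (X ^ a - F k ^ a) * f k ≡ (+ (r !)) ^ a * term k - g k
    difference = trans (distrib (X ^ a) (F k ^ a) (f k)) (cong (_- g k) (sym scaled-term))

lemma4p4 : (p a n : ℕ) → Prime p → 1 ≤ a → a ≤ 3 → 2 ℕ.* p ≤ 3 ℕ.* n → n < p →
    (+ p) ∣ sumTo n (λ k → sgn (a ℕ.* k) * ((+ (n C k)) ^ a) * binomZ ((+ (4 ℕ.* n)) - (+ (5 ℕ.* k))) (3 ℕ.* n ∸ 2 ℕ.* p))
lemma4p4 p a n isPrime 1≤a a≤3 2p≤3n n<p with ℕ.m≤n⇒∃[o]m+o≡n n<p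
... | r , refl = ∣⇒∣ᵤ (prime∣*-cancelˡ isPrime p∤m! (subst (+ p ∣ˢ_) m!*Σ≡Σ′
      (prime∣signed-binom-power-sum a isPrime 1≤a falling-polynomial deg<q)))
  where
  m = 3 ℕ.* n ∸ 2 ℕ.* p
  L : ℕ → ℤ
  L k = + (4 ℕ.* n) - + (5 ℕ.* k)
  coeff : ℕ → ℤ
  coeff k = sgn (a ℕ.* k) * (+ (n C k)) ^ a

  falling-polynomial : Polynomial m (λ k → falling (L k) m)
  falling-polynomial = polynomial-ext (λ k → cong (λ x → falling x m) (affine k)) (polynomial-falling (- + 5) (+ (4 ℕ.* n)) m)
    where
    reorder : ∀ f K F → - f * K + F ≡ F - f * K
    reorder = solve-∀
    affine : ∀ k → - + 5 * + k + + (4 ℕ.* n) ≡ L k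
    affine k = trans (reorder (+ 5) (+ k) (+ (4 ℕ.* n))) (cong (_-_ (+ (4 ℕ.* n))) (sym (ℤ.pos-* 5 k)))

  n+r≡m+3r+2 : n ℕ.+ r ≡ suc (suc (3 ℕ.* r ℕ.+ m))
  n+r≡m+3r+2 = ℕ.+-cancelʳ-≡ (2 ℕ.* n) _ _ (begin
    n ℕ.+ r ℕ.+ 2 ℕ.* n              ≡⟨ left n r ⟩
    3 ℕ.* n ℕ.+ r                     ≡⟨ cong (ℕ._+ r) (ℕ.m∸n+n≡m 2p≤3n) ⟨
    m ℕ.+ 2 ℕ.* p ℕ.+ r               ≡⟨ right n r m ⟩
    suc (suc (3 ℕ.* r ℕ.+ m)) ℕ.+ 2 ℕ.* n ∎)
    where
    left : ∀ n r → n ℕ.+ r ℕ.+ 2 ℕ.* n ≡ 3 ℕ.* n ℕ.+ r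
    left = ℕ-Solver.solve-∀
    right : ∀ n r m → m ℕ.+ 2 ℕ.* suc (n ℕ.+ r) ℕ.+ r ≡ suc (suc (3 ℕ.* r ℕ.+ m)) ℕ.+ 2 ℕ.* n
    right = ℕ-Solver.solve-∀

  deg<q : a ℕ.* r ℕ.+ m < n ℕ.+ r
  deg<q = ℕ.≤-<-trans (ℕ.+-monoˡ-≤ m (ℕ.*-monoˡ-≤ r a≤3))
    (subst (3 ℕ.* r ℕ.+ m <_) (sym n+r≡m+3r+2) (ℕ.m<n⇒m<1+n (ℕ.n<1+n _)))

  p∤m! : ¬ + p ∣ˢ + (m !)
  p∤m! p∣m! = prime∤! isPrime (ℕ.<-trans (ℕ.≤-<-trans (ℕ.m≤n+m m (a ℕ.* r)) deg<q) (ℕ.n<1+n _)) (∣⇒∣ᵤ p∣m!)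

  m!*Σ≡Σ′ : sumTo n (λ k → coeff k * falling (L k) m) ≡ + (m !) * sumTo n (λ k → coeff k * binomZ (L k) m)
  m!*Σ≡Σ′ = begin
    sumTo n (λ k → coeff k * falling (L k) m)          ≡⟨ sumTo-cong n (λ k → cong (coeff k *_) (!*binomZ (L k) m)) ⟨
    sumTo n (λ k → coeff k * (+ (m !) * binomZ (L k) m)) ≡⟨ sumTo-cong n (λ k → swap (coeff k) (+ (m !)) (binomZ (L k) m)) ⟩
    sumTo n (λ k → + (m !) * (coeff k * binomZ (L k) m)) ≡⟨ sumTo-* n (+ (m !)) (λ k → coeff k * binomZ (L k) m) ⟩
    + (m !) * sumTo n (λ k → coeff k * binomZ (L k) m)  ∎
    where
    swap : ∀ c M b → c * (M * b) ≡ M * (c * b)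
    swap = solve-∀
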